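{- For integers $k\ge1$ and $n\ge4$, \[\gamma_{[k]R}(C_4\square P_n)\le 4(n-2)\left\lceil\frac{k+4}{5}\right\rceil+8\left\lceil\frac{k+3-\left\lceil\frac{k+4}{5}\right\rceil}{3}\right\rceil<\frac{12nk+8k+108n-8}{15}.\]
   Context: $C_4$ is the cycle on 4 vertices, $P_n$ the path on $n$ vertices, and $\square$ the Cartesian product. For an integer $k\ge1$ and a labeling $f:V(G)\to\{0,1,\dots,k+1\}$, let $AN(v)=\{u\in N(v): f(u)>0\}$. The labeling $f$ is a $[k]$-Roman dominating function if every vertex $v$ with $f(v)<k$ satisfies $f(N[v])\ge k+|AN(v)|$, where $N[v]=N(v)\cup\{v\}$ and $f(X)=\sum_{x\in X}f(x)$. $\gamma_{[k]R}(G)$ is the minimum of $\sum_v f(v)$ over all $[k]$-Roman dominating functions $f$ on $G$. -}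

module Defs where

open import Data.Nat using (ℕ; zero; suc; _+_; _*_; _∸_; _≤_; _<_; _≡ᵇ_; _<ᵇ_; _/_; _%_)
open import Data.Nat.ListAction using (sum)
open import Data.Bool using (Bool; true; false; _∧_; _∨_)
open import Data.Fin using (Fin; toℕ)
open import Data.List using (List; _∷_; map; length; filterᵇ; allFin; cartesianProduct)
open import Data.Product using (_×_; _,_; Σ; ∃)

-- A finite simple graph: a vertex type, an enumeration of all vertices
-- (each listed exactly once), and a Boolean adjacency relation.
record Graph : Set₁ where
  field
    V     : Set
    verts : List V
    adj   : V → V → Bool
open Graph public

P : ℕ → Graph
P n = record
  { V = Fin n
  ; verts = allFin n
  ; adj = λ i j → (toℕ j ≡ᵇ suc (toℕ i)) ∨ (toℕ i ≡ᵇ suc (toℕ j)) }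

C4 : Graph
C4 = record
  { V = Fin 4
  ; verts = allFin 4
  ; adj = λ i j → (toℕ j ≡ᵇ ((toℕ i + 1) % 4)) ∨ (toℕ i ≡ᵇ ((toℕ j + 1) % 4)) }

_□_[_,_] : (G H : Graph) → (V G → V G → Bool) → (V H → V H → Bool) → Graph
G □ H [ eqG , eqH ] = record
  { V = V G × V H
  ; verts = cartesianProduct (verts G) (verts H)
  ; adj = λ { (g , h) (g' , h') → (eqG g g' ∧ adj H h h') ∨ (eqH h h' ∧ adj G g g') } }

eqFin : ∀ {m} → Fin m → Fin m → Bool
eqFin i j = toℕ i ≡ᵇ toℕ j

C4□P : ℕ → Graph
C4□P n = C4 □ (P n) [ eqFin , eqFin ]

module _ (G : Graph) where
  N : V G → List (V G)
  N v = filterᵇ (adj G v) (verts G)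

  sumOver : (V G → ℕ) → List (V G) → ℕ
  sumOver f xs = sum (map f xs)

  AN : (V G → ℕ) → V G → List (V G)
  AN f v = filterᵇ (λ u → 0 <ᵇ f u) (N v)

  IsKRDF : ℕ → (V G → ℕ) → Set
  IsKRDF k f =
    ((v : V G) → f v ≤ k + 1) ×
    ((v : V G) → f v < k → k + length (AN f v) ≤ sumOver f (v ∷ N v))

  weight : (V G → ℕ) → ℕ
  weight f = sumOver f (verts G)

  γkR≤ : ℕ → ℕ → Set
  γkR≤ k b = Σ (V G → ℕ) λ f → IsKRDF k f × weight f ≤ b

⌈_/suc_⌉ : ℕ → ℕ → ℕ
⌈ a /suc b ⌉ = (a + b) / suc b

bound17 : ℕ → ℕ → ℕ
bound17 k n = 4 * (n ∸ 2) * c + 8 * ⌈ (k + 3 ∸ c) /suc 2 ⌉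
  where c = ⌈ (k + 4) /suc 4 ⌉

-- Give the two end copies of C₄ the label d = ⌈(k+3−c)/3⌉ and all n−2 inner copies the
-- label c = ⌈(k+4)/5⌉. Every label is positive, so AN(v) = N(v) and the [k]-Roman
-- condition at v reads f(v) + Σ_{u ∈ N(v)} (f(u) − 1) ≥ k. An end vertex sees two d's in
-- its own copy of C₄ and a c in the next copy, which needs 3d + c ≥ k + 3; an inner vertex
-- sees two c's and two labels ≥ min(c, d), which needs 3c + 2 min(c, d) ≥ k + 4. Both follow
-- from the lower bounds on the ceilings, and their upper bounds give the strict estimate of
-- the weight 4(n−2)c + 8d.
module Submission where

open import Defs
open import Data.Bool using (Bool; true; false; _∨_; if_then_else_; T?)
open import Data.Bool.Properties using (∨-zeroʳ)
open import Data.Fin using (Fin; toℕ; fromℕ<; #_) renaming (zero to fz; suc to fs)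
open import Data.Fin.Properties using (toℕ-fromℕ<; toℕ<n)
open import Data.List using ([]; _∷_; _++_; map; length; filterᵇ; allFin; cartesianProduct; tabulate)
open import Data.List.Properties using (map-++; map-tabulate; map-∘; length-filter)
open import Data.Nat
open import Data.Nat.DivMod using (m≡m%n+[m/n]*n; m%n<n; m/n*n≤m)
open import Data.Nat.ListAction using (sum)
open import Data.Nat.ListAction.Properties using (sum-++)
open import Data.Nat.Properties
open import Algebra.Properties.CommutativeSemigroup +-commutativeSemigroup using (x∙yz≈y∙xz)
open import Data.Nat.Tactic.RingSolver using (solve; solve-∀)
open import Data.Product using (_×_; _,_; proj₂)
open import Data.Sum using (inj₁; inj₂)
open import Function using (_∘_; id)
open import Relation.Binary.PropositionalEquality
open import Relation.Nullary.Decidable using (dec-true; dec-false)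

-- A certificate for linear arithmetic: x ≤ y is a nonnegative combination of hypotheses,
-- and the identity exhibits (1 + m)(b − a) as s + (y − x).
≤-by-certificate : ∀ m {a b x y} s → x ≤ y → suc m * a + s + y ≡ suc m * b + x → a ≤ b
≤-by-certificate m {a} {b} {x} {y} s x≤y eq = *-cancelˡ-≤ (suc m) (+-cancelʳ-≤ x _ _ (begin
  suc m * a + x       ≤⟨ +-monoʳ-≤ (suc m * a) (m≤n+m x s) ⟩
  suc m * a + (s + x) ≤⟨ +-monoʳ-≤ (suc m * a) (+-monoʳ-≤ s x≤y) ⟩
  suc m * a + (s + y) ≡⟨ +-assoc (suc m * a) s y ⟨
  suc m * a + s + y   ≡⟨ eq ⟩
  suc m * b + x       ∎))
  where open ≤-Reasoning

⌈/suc⌉-lower : ∀ a b → a ≤ ⌈ a /suc b ⌉ * suc b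
⌈/suc⌉-lower a b = +-cancelʳ-≤ b a _ (begin
  a + b                                   ≡⟨ m≡m%n+[m/n]*n (a + b) (suc b) ⟩
  (a + b) % suc b + ⌈ a /suc b ⌉ * suc b  ≤⟨ +-monoˡ-≤ _ (s≤s⁻¹ (m%n<n (a + b) (suc b))) ⟩
  b + ⌈ a /suc b ⌉ * suc b                ≡⟨ +-comm b _ ⟩
  ⌈ a /suc b ⌉ * suc b + b                ∎)
  where open ≤-Reasoning

⌈/suc⌉-upper : ∀ a b → ⌈ a /suc b ⌉ * suc b ≤ a + b
⌈/suc⌉-upper a b = m/n*n≤m (a + b) (suc b)

module CeilingArithmetic {k c d : ℕ} (1≤k : 1 ≤ k)
  (c-lower : k + 4 ≤ c * 5) (c-upper : c * 5 ≤ k + 4 + 4)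
  (d-lower : k + 3 ∸ c ≤ d * 3) (d-upper : d * 3 ≤ k + 3 ∸ c + 2) where

  1≤c : 1 ≤ c
  1≤c = *-cancelʳ-< 5 0 c (≤-trans (≤-trans 1≤k (m≤m+n k 4)) c-lower)

  c≤k+1 : c ≤ k + 1
  c≤k+1 = ≤-by-certificate 4 1 combination (solve (k ∷ c ∷ []))
    where
    combination : c * 5 + 4 * 1 ≤ k + 4 + 4 + 4 * k
    combination = +-mono-≤ c-upper (*-monoʳ-≤ 4 1≤k)

  c≤k+3 : c ≤ k + 3
  c≤k+3 = ≤-trans c≤k+1 (+-monoʳ-≤ k (s≤s z≤n))

  k+3≤3d+c : k + 3 ≤ d * 3 + c
  k+3≤3d+c = begin
    k + 3             ≡⟨ m∸n+n≡m c≤k+3 ⟨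
    k + 3 ∸ c + c     ≤⟨ +-monoˡ-≤ c d-lower ⟩
    d * 3 + c         ∎
    where open ≤-Reasoning

  3d+c≤k+5 : d * 3 + c ≤ k + 5
  3d+c≤k+5 = begin
    d * 3 + c            ≤⟨ +-monoˡ-≤ c d-upper ⟩
    k + 3 ∸ c + 2 + c    ≡⟨ +-assoc (k + 3 ∸ c) 2 c ⟩
    k + 3 ∸ c + (2 + c)  ≡⟨ cong (k + 3 ∸ c +_) (+-comm 2 c) ⟩
    k + 3 ∸ c + (c + 2)  ≡⟨ +-assoc (k + 3 ∸ c) c 2 ⟨
    k + 3 ∸ c + c + 2    ≡⟨ cong (_+ 2) (m∸n+n≡m c≤k+3) ⟩
    k + 3 + 2            ≡⟨ +-assoc k 3 2 ⟩
    k + 5                ∎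
    where open ≤-Reasoning

  1≤d : 1 ≤ d
  1≤d = *-cancelʳ-< 3 0 d (+-cancelʳ-< c 0 (d * 3) (begin-strict
    c          ≤⟨ c≤k+1 ⟩
    k + 1      <⟨ +-monoʳ-< k (s≤s (s≤s z≤n)) ⟩
    k + 3      ≤⟨ k+3≤3d+c ⟩
    d * 3 + c  ∎))
    where open ≤-Reasoning

  d≤k+1 : d ≤ k + 1
  d≤k+1 = ≤-by-certificate 2 1 combination (solve (k ∷ c ∷ d ∷ []))
    where
    combination : d * 3 + c + (1 + 2 * 1) ≤ k + 5 + (c + 2 * k)
    combination = +-mono-≤ 3d+c≤k+5 (+-mono-≤ 1≤c (*-monoʳ-≤ 2 1≤k))

  k+4≤3c+2d : k + 4 ≤ c * 3 + d * 2
  k+4≤3c+2d = ≤-by-certificate 14 0 combination (solve (k ∷ c ∷ d ∷ []))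
    where
    combination : 10 * (k + 3) + (7 * (k + 4) + 2 * 1) ≤ 10 * (d * 3 + c) + (7 * (c * 5) + 2 * k)
    combination = +-mono-≤ (*-monoʳ-≤ 10 k+3≤3d+c)
                           (+-mono-≤ (*-monoʳ-≤ 7 c-lower) (*-monoʳ-≤ 2 1≤k))

  k+4≤3c+2[c⊓d] : k + 4 ≤ c * 3 + (c ⊓ d) * 2
  k+4≤3c+2[c⊓d] with ⊓-sel c d
  ... | inj₁ c⊓d≡c rewrite c⊓d≡c = ≤-trans c-lower (≤-reflexive (solve (c ∷ [])))
  ... | inj₂ c⊓d≡d rewrite c⊓d≡d = k+4≤3c+2d

  15-weight<bound : ∀ M → 15 * (4 * M * c + 8 * d) < 12 * (2 + M) * k + 8 * k + 108 * (2 + M) ∸ 8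
  15-weight<bound M = m+n≤o⇒m≤o∸n (suc (15 * (4 * M * c + 8 * d))) bound
    where
    combination : 12 * M * (c * 5) + (40 * (d * 3 + c) + 8 * (k + 4))
                ≤ 12 * M * (k + 4 + 4) + (40 * (k + 5) + 8 * (c * 5))
    combination = +-mono-≤ (*-monoʳ-≤ (12 * M) c-upper)
                           (+-mono-≤ (*-monoʳ-≤ 40 3d+c≤k+5) (*-monoʳ-≤ 8 c-lower))
    bound : suc (15 * (4 * M * c + 8 * d)) + 8 ≤ 12 * (2 + M) * k + 8 * k + 108 * (2 + M)
    bound = ≤-by-certificate 0 (12 * M + 39) combination (solve (M ∷ k ∷ c ∷ d ∷ []))

end-excess : ∀ {k c d} → 1 ≤ c → 1 ≤ d → k + 3 ≤ d * 3 + c → k ≤ d + (2 * (d ∸ 1) + (c ∸ 1))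
end-excess {k} {suc c} {suc d} _ _ k+3≤3d+c = +-cancelʳ-≤ 3 k _ (≤-trans k+3≤3d+c (≤-reflexive eq))
  where
  eq : suc d * 3 + suc c ≡ suc d + (2 * d + c) + 3
  eq = solve (c ∷ d ∷ [])

inner-excess : ∀ {k c e} → 1 ≤ c → 1 ≤ e → k + 4 ≤ c * 3 + e * 2 →
  k ≤ c + (2 * (c ∸ 1) + ((e ∸ 1) + (e ∸ 1)))
inner-excess {k} {suc c} {suc e} _ _ k+4≤3c+2e = +-cancelʳ-≤ 4 k _ (≤-trans k+4≤3c+2e (≤-reflexive eq))
  where
  eq : suc c * 3 + suc e * 2 ≡ suc c + (2 * c + (e + e)) + 4
  eq = solve (c ∷ e ∷ [])

module _ {A : Set} where

  sum-map-filterᵇ : ∀ (p : A → Bool) (F : A → ℕ) xs →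
    sum (map F (filterᵇ p xs)) ≡ sum (map (λ x → if p x then F x else 0) xs)
  sum-map-filterᵇ p F [] = refl
  sum-map-filterᵇ p F (x ∷ xs) with p x
  ... | true  = cong (F x +_) (sum-map-filterᵇ p F xs)
  ... | false = sum-map-filterᵇ p F xs

  sum-map-mono : ∀ {F G : A → ℕ} → (∀ x → F x ≤ G x) → ∀ xs → sum (map F xs) ≤ sum (map G xs)
  sum-map-mono F≤G []       = z≤n
  sum-map-mono F≤G (x ∷ xs) = +-mono-≤ (F≤G x) (sum-map-mono F≤G xs)

  sum-map-∸1 : ∀ (F : A → ℕ) → (∀ x → 1 ≤ F x) → ∀ xs →
    length xs + sum (map (λ x → F x ∸ 1) xs) ≡ sum (map F xs)
  sum-map-∸1 F positive []       = refl
  sum-map-∸1 F positive (x ∷ xs) = begin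
    suc (length xs + ((F x ∸ 1) + S))  ≡⟨ cong suc (x∙yz≈y∙xz (length xs) (F x ∸ 1) S) ⟩
    suc ((F x ∸ 1) + (length xs + S))  ≡⟨ cong (_+ (length xs + S)) (+-comm 1 (F x ∸ 1)) ⟩
    (F x ∸ 1) + 1 + (length xs + S)    ≡⟨ cong₂ _+_ (m∸n+n≡m (positive x)) (sum-map-∸1 F positive xs) ⟩
    F x + sum (map F xs)               ∎
    where
    open ≡-Reasoning
    S : ℕ
    S = sum (map (λ x → F x ∸ 1) xs)

module _ {A B : Set} where

  sum-cartesianProduct : ∀ (F : A × B → ℕ) xs ys →
    sum (map F (cartesianProduct xs ys)) ≡ sum (map (λ x → sum (map (λ y → F (x , y)) ys)) xs)
  sum-cartesianProduct F []       ys = refl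
  sum-cartesianProduct F (x ∷ xs) ys = begin
    sum (map F (map (x ,_) ys ++ cartesianProduct xs ys))
      ≡⟨ cong sum (map-++ F (map (x ,_) ys) _) ⟩
    sum (map F (map (x ,_) ys) ++ map F (cartesianProduct xs ys))
      ≡⟨ sum-++ (map F (map (x ,_) ys)) _ ⟩
    sum (map F (map (x ,_) ys)) + sum (map F (cartesianProduct xs ys))
      ≡⟨ cong₂ _+_ (cong sum (sym (map-∘ ys))) (sum-cartesianProduct F xs ys) ⟩
    sum (map (λ y → F (x , y)) ys) + sum (map (λ x → sum (map (λ y → F (x , y)) ys)) xs)
      ∎
    where open ≡-Reasoning

≤-sum-tabulate : ∀ {n} (F : Fin n → ℕ) b → F b ≤ sum (tabulate F)
≤-sum-tabulate F fz     = m≤m+n _ _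
≤-sum-tabulate F (fs b) = m≤n⇒m≤o+n (F fz) (≤-sum-tabulate (F ∘ fs) b)

+-≤-sum-tabulate : ∀ {n} (F : Fin n → ℕ) b₁ b₂ → toℕ b₁ < toℕ b₂ → F b₁ + F b₂ ≤ sum (tabulate F)
+-≤-sum-tabulate F fz      (fs b₂) _          = +-monoʳ-≤ (F fz) (≤-sum-tabulate (F ∘ fs) b₂)
+-≤-sum-tabulate F (fs b₁) (fs b₂) (s≤s b₁<b₂) =
  m≤n⇒m≤o+n (F fz) (+-≤-sum-tabulate (F ∘ fs) b₁ b₂ b₁<b₂)

module _ {n : ℕ} (p : Fin n → Bool) (F : Fin n → ℕ) where

  private
    F|p : Fin n → ℕ
    F|p x = if p x then F x else 0

    F|p≡F : ∀ {b} → p b ≡ true → F|p b ≡ F b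
    F|p≡F pb = cong (λ z → if z then F _ else 0) pb

    sum-allFin : sum (map F|p (allFin n)) ≡ sum (tabulate F|p)
    sum-allFin = cong sum (map-tabulate id F|p)

  ≤-sum-allFin-if : ∀ {b} → p b ≡ true → F b ≤ sum (map F|p (allFin n))
  ≤-sum-allFin-if {b} pb = begin
    F b                      ≡⟨ F|p≡F pb ⟨
    F|p b                    ≤⟨ ≤-sum-tabulate F|p b ⟩
    sum (tabulate F|p)       ≡⟨ sum-allFin ⟨
    sum (map F|p (allFin n)) ∎
    where open ≤-Reasoning

  +-≤-sum-allFin-if : ∀ {b₁ b₂} → toℕ b₁ < toℕ b₂ → p b₁ ≡ true → p b₂ ≡ true →
    F b₁ + F b₂ ≤ sum (map F|p (allFin n))
  +-≤-sum-allFin-if {b₁} {b₂} b₁<b₂ pb₁ pb₂ = begin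
    F b₁ + F b₂              ≡⟨ cong₂ _+_ (F|p≡F pb₁) (F|p≡F pb₂) ⟨
    F|p b₁ + F|p b₂          ≤⟨ +-≤-sum-tabulate F|p b₁ b₂ b₁<b₂ ⟩
    sum (tabulate F|p)       ≡⟨ sum-allFin ⟨
    sum (map F|p (allFin n)) ∎
    where open ≤-Reasoning

module _ (G : Graph) {k : ℕ} {f : V G → ℕ} where

  IsKRDF-of-excess : (∀ v → 1 ≤ f v) → (∀ v → f v ≤ k + 1) →
    (∀ v → k ≤ f v + sum (map (λ u → f u ∸ 1) (N G v))) → IsKRDF G k f
  IsKRDF-of-excess positive bounded excess = bounded , λ v _ → begin
    k + length (AN G f v)                  ≤⟨ +-monoʳ-≤ k (length-filter (T? ∘ (λ u → 0 <ᵇ f u)) (N G v)) ⟩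
    k + length (N G v)                     ≤⟨ +-monoˡ-≤ (length (N G v)) (excess v) ⟩
    f v + excess-sum v + length (N G v)    ≡⟨ +-assoc (f v) _ _ ⟩
    f v + (excess-sum v + length (N G v))  ≡⟨ cong (f v +_) (+-comm (excess-sum v) _) ⟩
    f v + (length (N G v) + excess-sum v)  ≡⟨ cong (f v +_) (sum-map-∸1 f positive (N G v)) ⟩
    f v + sum (map f (N G v))              ∎
    where
    open ≤-Reasoning
    excess-sum : V G → ℕ
    excess-sum v = sum (map (λ u → f u ∸ 1) (N G v))

C4-next C4-prev : Fin 4 → Fin 4
C4-next fz                = fs fz
C4-next (fs fz)           = fs (fs fz)
C4-next (fs (fs fz))      = fs (fs (fs fz))
C4-next (fs (fs (fs fz))) = fz
C4-prev fz                = fs (fs (fs fz))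
C4-prev (fs fz)           = fz
C4-prev (fs (fs fz))      = fs fz
C4-prev (fs (fs (fs fz))) = fs (fs fz)

C4-adj-next : ∀ i → adj C4 i (C4-next i) ≡ true
C4-adj-next fz                = refl
C4-adj-next (fs fz)           = refl
C4-adj-next (fs (fs fz))      = refl
C4-adj-next (fs (fs (fs fz))) = refl

C4-adj-prev : ∀ i → adj C4 i (C4-prev i) ≡ true
C4-adj-prev fz                = refl
C4-adj-prev (fs fz)           = refl
C4-adj-prev (fs (fs fz))      = refl
C4-adj-prev (fs (fs (fs fz))) = refl

sum-allFin4-≥ : ∀ (R : Fin 4 → ℕ) i → R i + (R (C4-next i) + R (C4-prev i)) ≤ sum (map R (allFin 4))
sum-allFin4-≥ R fz = ≤-trans (m≤m+n _ (R (# 2)))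
  (≤-reflexive (rearrange (R (# 0)) (R (# 1)) (R (# 2)) (R (# 3))))
  where
  rearrange : ∀ r₀ r₁ r₂ r₃ → r₀ + (r₁ + r₃) + r₂ ≡ r₀ + (r₁ + (r₂ + (r₃ + 0)))
  rearrange = solve-∀
sum-allFin4-≥ R (fs fz) = ≤-trans (m≤m+n _ (R (# 3)))
  (≤-reflexive (rearrange (R (# 0)) (R (# 1)) (R (# 2)) (R (# 3))))
  where
  rearrange : ∀ r₀ r₁ r₂ r₃ → r₁ + (r₂ + r₀) + r₃ ≡ r₀ + (r₁ + (r₂ + (r₃ + 0)))
  rearrange = solve-∀
sum-allFin4-≥ R (fs (fs fz)) = ≤-trans (m≤m+n _ (R (# 0)))
  (≤-reflexive (rearrange (R (# 0)) (R (# 1)) (R (# 2)) (R (# 3))))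
  where
  rearrange : ∀ r₀ r₁ r₂ r₃ → r₂ + (r₃ + r₁) + r₀ ≡ r₀ + (r₁ + (r₂ + (r₃ + 0)))
  rearrange = solve-∀
sum-allFin4-≥ R (fs (fs (fs fz))) = ≤-trans (m≤m+n _ (R (# 1)))
  (≤-reflexive (rearrange (R (# 0)) (R (# 1)) (R (# 2)) (R (# 3))))
  where
  rearrange : ∀ r₀ r₁ r₂ r₃ → r₃ + (r₀ + r₂) + r₁ ≡ r₀ + (r₁ + (r₂ + (r₃ + 0)))
  rearrange = solve-∀

eqFin-refl : ∀ {m} (i : Fin m) → eqFin i i ≡ true
eqFin-refl i = dec-true (toℕ i ≟ toℕ i) refl

P-adj-suc : ∀ {n} (j b : Fin n) → toℕ b ≡ suc (toℕ j) → adj (P n) j b ≡ true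
P-adj-suc j b eq rewrite eq | eqFin-refl j = refl

P-adj-pred : ∀ {n} (j b : Fin n) → toℕ j ≡ suc (toℕ b) → adj (P n) j b ≡ true
P-adj-pred j b eq rewrite eq | eqFin-refl b = ∨-zeroʳ _

module _ {n : ℕ} (w : Fin n → ℕ) (i : Fin 4) (j : Fin n) where

  private
    v : V (C4□P n)
    v = i , j

    row : Fin 4 → ℕ
    row i′ = sum (map (λ b → if adj (C4□P n) v (i′ , b) then w b else 0) (allFin n))

    path≤row : sum (map w (N (P n) j)) ≤ row i
    path≤row = begin
      sum (map w (N (P n) j))                                         ≡⟨ sum-map-filterᵇ (adj (P n) j) w (allFin n) ⟩
      sum (map (λ b → if adj (P n) j b then w b else 0) (allFin n))   ≤⟨ sum-map-mono pointwise (allFin n) ⟩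
      row i                                                           ∎
      where
      open ≤-Reasoning
      pointwise : ∀ b → (if adj (P n) j b then w b else 0) ≤ (if adj (C4□P n) v (i , b) then w b else 0)
      pointwise b rewrite eqFin-refl i with adj (P n) j b
      ... | true  = ≤-refl
      ... | false = z≤n

    layer-adj : ∀ {i′} → adj C4 i i′ ≡ true → adj (C4□P n) v (i′ , j) ≡ true
    layer-adj {i′} i~i′ rewrite eqFin-refl j | i~i′ = ∨-zeroʳ _

    w≤row : ∀ {i′} → adj C4 i i′ ≡ true → w j ≤ row i′
    w≤row {i′} i~i′ = ≤-sum-allFin-if (λ b → adj (C4□P n) v (i′ , b)) w (layer-adj i~i′)

  sum-N-C4□P-≥ : 2 * w j + sum (map w (N (P n) j)) ≤ sum (map (w ∘ proj₂) (N (C4□P n) v))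
  sum-N-C4□P-≥ = begin
    2 * w j + sum (map w (N (P n) j))                  ≡⟨ +-comm (2 * w j) _ ⟩
    sum (map w (N (P n) j)) + (w j + (w j + 0))        ≡⟨ cong (λ x → sum (map w (N (P n) j)) + (w j + x)) (+-identityʳ (w j)) ⟩
    sum (map w (N (P n) j)) + (w j + w j)              ≤⟨ +-mono-≤ path≤row
                                                            (+-mono-≤ (w≤row (C4-adj-next i)) (w≤row (C4-adj-prev i))) ⟩
    row i + (row (C4-next i) + row (C4-prev i))        ≤⟨ sum-allFin4-≥ row i ⟩
    sum (map row (allFin 4))                           ≡⟨ sum-cartesianProduct (λ u → if adj (C4□P n) v u then w (proj₂ u) else 0)
                                                                                (allFin 4) (allFin n) ⟨
    sum (map (λ u → if adj (C4□P n) v u then w (proj₂ u) else 0) (verts (C4□P n)))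
                                                       ≡⟨ sum-map-filterᵇ (adj (C4□P n) v) (w ∘ proj₂) (verts (C4□P n)) ⟨
    sum (map (w ∘ proj₂) (N (C4□P n) v))               ∎
    where open ≤-Reasoning

module _ {n : ℕ} (F : ℕ → ℕ) (j : Fin n) where

  private
    Σ-N : ℕ
    Σ-N = sum (map (F ∘ toℕ) (N (P n) j))

    if-sum : Σ-N ≡ sum (map (λ b → if adj (P n) j b then F (toℕ b) else 0) (allFin n))
    if-sum = sum-map-filterᵇ (adj (P n) j) (F ∘ toℕ) (allFin n)

  sum-N-P-≥-next : ∀ {t} → toℕ j ≡ t → (t+1<n : suc t < n) → F (suc t) ≤ Σ-N
  sum-N-P-≥-next {t} refl t+1<n = begin
    F (suc t)              ≡⟨ cong F (toℕ-fromℕ< t+1<n) ⟨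
    F (toℕ (fromℕ< t+1<n)) ≤⟨ ≤-sum-allFin-if (adj (P n) j) (F ∘ toℕ) (P-adj-suc j _ (toℕ-fromℕ< t+1<n)) ⟩
    _                      ≡⟨ if-sum ⟨
    Σ-N                    ∎
    where open ≤-Reasoning

  sum-N-P-≥-prev : ∀ {t} → toℕ j ≡ suc t → F t ≤ Σ-N
  sum-N-P-≥-prev {t} j≡t+1 = begin
    F t                   ≡⟨ cong F (toℕ-fromℕ< t<n) ⟨
    F (toℕ (fromℕ< t<n))  ≤⟨ ≤-sum-allFin-if (adj (P n) j) (F ∘ toℕ)
                               (P-adj-pred j _ (trans j≡t+1 (cong suc (sym (toℕ-fromℕ< t<n))))) ⟩
    _                     ≡⟨ if-sum ⟨
    Σ-N                   ∎
    where
    open ≤-Reasoning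
    t<n : t < n
    t<n = <-trans (n<1+n t) (subst (_< n) j≡t+1 (toℕ<n j))

  sum-N-P-≥-both : ∀ {t} → toℕ j ≡ suc t → (t+2<n : suc (suc t) < n) → F t + F (suc (suc t)) ≤ Σ-N
  sum-N-P-≥-both {t} j≡t+1 t+2<n = begin
    F t + F (suc (suc t))                             ≡⟨ cong₂ _+_ (cong F (toℕ-fromℕ< t<n)) (cong F (toℕ-fromℕ< t+2<n)) ⟨
    F (toℕ (fromℕ< t<n)) + F (toℕ (fromℕ< t+2<n))     ≤⟨ +-≤-sum-allFin-if (adj (P n) j) (F ∘ toℕ) prev<next
                                                           (P-adj-pred j _ (trans j≡t+1 (cong suc (sym (toℕ-fromℕ< t<n)))))
                                                           (P-adj-suc j _ (trans (toℕ-fromℕ< t+2<n) (cong suc (sym j≡t+1)))) ⟩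
    _                                                 ≡⟨ if-sum ⟨
    Σ-N                                               ∎
    where
    open ≤-Reasoning
    t<n : t < n
    t<n = <-trans (n<1+n t) (<-trans (n<1+n (suc t)) t+2<n)
    prev<next : toℕ (fromℕ< t<n) < toℕ (fromℕ< t+2<n)
    prev<next rewrite toℕ-fromℕ< t<n | toℕ-fromℕ< t+2<n = <-trans (n<1+n t) (n<1+n (suc t))

sum-tabulate-last : ∀ r {c d} → sum (tabulate {n = suc r} (λ j → if toℕ j ≡ᵇ r then d else c)) ≡ r * c + d
sum-tabulate-last zero    {c} {d} = +-identityʳ d
sum-tabulate-last (suc r) {c} {d} = trans (cong (c +_) (sum-tabulate-last r)) (sym (+-assoc c (r * c) d))

module C4□P-Labelling (m : ℕ) {k c d : ℕ}
  (1≤c : 1 ≤ c) (1≤d : 1 ≤ d) (c≤k+1 : c ≤ k + 1) (d≤k+1 : d ≤ k + 1)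
  (k+3≤3d+c : k + 3 ≤ d * 3 + c) (k+4≤3c+2[c⊓d] : k + 4 ≤ c * 3 + (c ⊓ d) * 2) where

  label : ℕ → ℕ
  label t = if (t ≡ᵇ 0) ∨ (t ≡ᵇ 3 + m) then d else c

  labelling : V (C4□P (4 + m)) → ℕ
  labelling = label ∘ toℕ ∘ proj₂

  label-elim : ∀ (Q : ℕ → Set) → Q c → Q d → ∀ t → Q (label t)
  label-elim Q Qc Qd t with (t ≡ᵇ 0) ∨ (t ≡ᵇ 3 + m)
  ... | true  = Qd
  ... | false = Qc

  label-inner : ∀ {t} → t < 2 + m → label (suc t) ≡ c
  label-inner {t} t<2+m rewrite dec-false (t ≟ 2 + m) (<⇒≢ t<2+m) = refl

  label-last : label (3 + m) ≡ d
  label-last rewrite dec-true (m ≟ m) refl = refl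

  data Position : ℕ → Set where
    first : Position 0
    inner : ∀ {t} → t < 2 + m → Position (suc t)
    last  : Position (3 + m)

  position : ∀ {t} → t < 4 + m → Position t
  position {zero}  _             = first
  position {suc t} (s≤s t<3+m) with m≤n⇒m<n∨m≡n (s≤s⁻¹ t<3+m)
  ... | inj₁ t<2+m = inner t<2+m
  ... | inj₂ refl  = last

  excess-label : ℕ → ℕ
  excess-label t = label t ∸ 1

  layer-excess : ∀ j →
    k ≤ label (toℕ j) + (2 * excess-label (toℕ j) + sum (map (excess-label ∘ toℕ) (N (P (4 + m)) j)))
  layer-excess j = at (position (toℕ<n j)) refl
    where
    Σ-N : ℕ
    Σ-N = sum (map (excess-label ∘ toℕ) (N (P (4 + m)) j))

    end : c ∸ 1 ≤ Σ-N → k ≤ d + (2 * (d ∸ 1) + Σ-N)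
    end c-1≤Σ = ≤-trans (end-excess 1≤c 1≤d k+3≤3d+c)
                        (+-monoʳ-≤ d (+-monoʳ-≤ (2 * (d ∸ 1)) c-1≤Σ))

    at : ∀ {t} → Position t → toℕ j ≡ t → k ≤ label t + (2 * excess-label t + Σ-N)
    at first j≡0 = end (sum-N-P-≥-next excess-label j j≡0 (s≤s (s≤s z≤n)))
    at last j≡3+m rewrite label-last =
      end (subst (λ e → e ∸ 1 ≤ Σ-N) (label-inner (n<1+n (suc m)))
                 (sum-N-P-≥-prev excess-label j j≡3+m))
    at (inner {t} t<2+m) j≡t+1 rewrite label-inner t<2+m = ≤-trans
      (inner-excess 1≤c (⊓-glb 1≤c 1≤d) k+4≤3c+2[c⊓d])
      (+-monoʳ-≤ c (+-monoʳ-≤ (2 * (c ∸ 1)) (≤-trans (+-mono-≤ (min≤ t) (min≤ (suc (suc t))))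
        (sum-N-P-≥-both excess-label j j≡t+1 (s≤s (s≤s t<2+m))))))
      where
      min≤ : ∀ t → c ⊓ d ∸ 1 ≤ excess-label t
      min≤ = label-elim (λ e → c ⊓ d ∸ 1 ≤ e ∸ 1) (∸-monoˡ-≤ 1 (m⊓n≤m c d)) (∸-monoˡ-≤ 1 (m⊓n≤n c d))

  labelling-isKRDF : IsKRDF (C4□P (4 + m)) k labelling
  labelling-isKRDF = IsKRDF-of-excess (C4□P (4 + m))
    (λ (_ , j) → label-elim (1 ≤_) 1≤c 1≤d (toℕ j))
    (λ (_ , j) → label-elim (_≤ k + 1) c≤k+1 d≤k+1 (toℕ j))
    (λ (i , j) → ≤-trans (layer-excess j) (+-monoʳ-≤ _ (sum-N-C4□P-≥ (excess-label ∘ toℕ) i j)))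

  weight-labelling : weight (C4□P (4 + m)) labelling ≡ 4 * (2 + m) * c + 8 * d
  weight-labelling = begin
    weight (C4□P (4 + m)) labelling  ≡⟨ sum-cartesianProduct labelling (allFin 4) (allFin (4 + m)) ⟩
    S + (S + (S + (S + 0)))          ≡⟨ cong (λ s → s + (s + (s + (s + 0)))) layer-sum ⟩
    T + (T + (T + (T + 0)))          ≡⟨ four-layers (2 + m) c d ⟩
    4 * (2 + m) * c + 8 * d          ∎
    where
    open ≡-Reasoning
    S T : ℕ
    S = sum (map (label ∘ toℕ) (allFin (4 + m)))
    T = d + ((2 + m) * c + d)
    layer-sum : S ≡ T
    layer-sum = trans (cong sum (map-tabulate {n = 4 + m} id (label ∘ toℕ)))
                      (cong (d +_) (sum-tabulate-last (2 + m) {c} {d}))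
    four-layers : ∀ r c d → let t = d + (r * c + d) in t + (t + (t + (t + 0))) ≡ 4 * r * c + 8 * d
    four-layers = solve-∀

mainTheorem17 : (k n : ℕ) → 1 ≤ k → 4 ≤ n →
    γkR≤ (C4□P n) k (bound17 k n) ×
    15 * bound17 k n < 12 * n * k + 8 * k + 108 * n ∸ 8
mainTheorem17 k (suc (suc (suc (suc m)))) 1≤k (s≤s (s≤s (s≤s (s≤s _)))) =
  (labelling , labelling-isKRDF , ≤-reflexive weight-labelling) , 15-weight<bound (2 + m)
  where
  c d : ℕ
  c = ⌈ (k + 4) /suc 4 ⌉
  d = ⌈ (k + 3 ∸ c) /suc 2 ⌉
  open CeilingArithmetic {k} {c} {d} 1≤k (⌈/suc⌉-lower (k + 4) 4) (⌈/suc⌉-upper (k + 4) 4)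
    (⌈/suc⌉-lower (k + 3 ∸ c) 2) (⌈/suc⌉-upper (k + 3 ∸ c) 2)
  open C4□P-Labelling m 1≤c 1≤d c≤k+1 d≤k+1 k+3≤3d+c k+4≤3c+2[c⊓d]
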